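{- For any ordinal $\alpha$ with $0<\alpha<\epsilon_0$, there is a unique canonical type $\sigma_\alpha$ with $R(\sigma_\alpha)=\alpha$.
   Context: Simple types are generated by $\sigma::=\mathtt{N}\mid\sigma\to\sigma\mid\sigma\times\sigma$. Uncurried types are generated by the grammar $\rho::=\mathtt{N}\mid\theta\to\mathtt{N}$, $\theta::=\rho\mid\theta\times\rho$ (products left-associated). Ordinal ranks $R(\rho),R(\theta)<\epsilon_0$ are assigned inductively to certain uncurried types, called canonical types, by: $R(\mathtt{N})=1$; if $\rho_1,\dots,\rho_n$ are canonical with $R(\rho_1)\ge R(\rho_2)\ge\cdots\ge R(\rho_n)$ then $\rho_1\times\cdots\times\rho_n$ is canonical with $R(\rho_1\times\cdots\times\rho_n)=R(\rho_1)+\cdots+R(\rho_n)$ (ordinal addition); if $\theta$ is canonical with $R(\theta)=\alpha$ then $\theta\to\mathtt{N}$ is canonical with $R(\theta\to\mathtt{N})=\omega^\alpha$. -}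

module Defs where

open import Data.Bool using (Bool; true; false; _∧_; _∨_; if_then_else_)
open import Data.List using (List; []; _∷_; _++_; [_])
open import Data.List.Relation.Unary.All using (All)
open import Data.List.Relation.Unary.Linked using (Linked)
open import Data.Sum using (_⊎_)
open import Relation.Binary.PropositionalEquality using (_≡_)
open import Relation.Nullary using (¬_)

-- A raw term  ω^ a + b  denotes ω^a + b; the ordinals < ε₀ are exactly
-- the terms satisfying IsCNF (exponents weakly decreasing), and each
-- such ordinal has exactly one such representation, so ordinal equality
-- is propositional equality of CNF terms.

data Ord : Set where
  𝟎    : Ord
  ω^_+_ : Ord → Ord → Ord

infixr 6 ω^_+_

data _<_ : Ord → Ord → Set where
  0<ω  : ∀ {a b} → 𝟎 < (ω^ a + b)
  exp< : ∀ {a b c d} → a < c → (ω^ a + b) < (ω^ c + d)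
  tail< : ∀ {a b d} → b < d → (ω^ a + b) < (ω^ a + d)

_≤_ : Ord → Ord → Set
a ≤ b = a < b ⊎ a ≡ b

data LeadExp≤ (a : Ord) : Ord → Set where
  lead𝟎 : LeadExp≤ a 𝟎
  lead≤ : ∀ {c d} → c ≤ a → LeadExp≤ a (ω^ c + d)

data IsCNF : Ord → Set where
  cnf𝟎 : IsCNF 𝟎
  cnfω : ∀ {a b} → IsCNF a → IsCNF b → LeadExp≤ a b → IsCNF (ω^ a + b)

_==ᵇ_ : Ord → Ord → Bool
𝟎 ==ᵇ 𝟎 = true
𝟎 ==ᵇ (ω^ _ + _) = false
(ω^ _ + _) ==ᵇ 𝟎 = false
(ω^ a + b) ==ᵇ (ω^ c + d) = (a ==ᵇ c) ∧ (b ==ᵇ d)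

_<ᵇ_ : Ord → Ord → Bool
𝟎 <ᵇ 𝟎 = false
𝟎 <ᵇ (ω^ _ + _) = true
(ω^ _ + _) <ᵇ 𝟎 = false
(ω^ a + b) <ᵇ (ω^ c + d) = (a <ᵇ c) ∨ ((a ==ᵇ c) ∧ (b <ᵇ d))

infixl 5 _⊕_
_⊕_ : Ord → Ord → Ord
𝟎 ⊕ c = c
(ω^ a + b) ⊕ 𝟎 = ω^ a + b
(ω^ a + b) ⊕ (ω^ c + d) =
  if a <ᵇ c then (ω^ c + d) else (ω^ a + (b ⊕ (ω^ c + d)))

one : Ord
one = ω^ 𝟎 + 𝟎

-- Uncurried types:  ρ ::= N | θ → N ,  θ ::= ρ | θ × ρ

mutual
  data Rho : Set where
    N    : Rho
    _⇒N  : Theta → Rho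

  data Theta : Set where
    ⟨_⟩  : Rho → Theta
    _⊗_  : Theta → Rho → Theta

factors : Theta → List Rho
factors ⟨ ρ ⟩ = [ ρ ]
factors (θ ⊗ ρ) = factors θ ++ [ ρ ]

-- rank (meaningful on canonical types)
mutual
  rankR : Rho → Ord
  rankR N = one
  rankR (θ ⇒N) = ω^ rankT θ + 𝟎

  rankT : Theta → Ord
  rankT ⟨ ρ ⟩ = rankR ρ
  rankT (θ ⊗ ρ) = rankT θ ⊕ rankR ρ

mutual
  data CanonicalR : Rho → Set where
    canN   : CanonicalR N
    canArr : ∀ {θ} → CanonicalT θ → CanonicalR (θ ⇒N)

  data CanonicalT (θ : Theta) : Set where
    canProd : All CanonicalR (factors θ)
            → Linked (λ ρ ρ' → rankR ρ' ≤ rankR ρ) (factors θ)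
            → CanonicalT θ

module Submission where

-- Ordinals are Cantor normal forms, so the whole proof rests on one
-- observation: a canonical θ = ρ₁ × ⋯ × ρₙ has rank ω^e₁ + ⋯ + ω^eₙ,
-- *syntactically*, where eᵢ is the exponent of ρᵢ (0 for N, R(θ') for
-- θ' → N).  Because e₁ ≥ ⋯ ≥ eₙ, each step of the ordinal sum in R(θ)
-- just appends a monomial (no absorption happens); this is `sum-snoc`.

open import Defs
open import Data.Empty using (⊥-elim)
open import Data.Product using (Σ; _×_; _,_; proj₁)
open import Data.Sum using (inj₁; inj₂)
open import Data.Bool using (true; false)
open import Data.List using (List; []; _∷_; _++_; [_]; map; foldl)
open import Data.List.Properties using (map-++; ++-assoc; ++-identityʳ; ∷-injective; ∷ʳ-injective; ++-conicalʳ)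
open import Data.List.Relation.Unary.All using (All; []; _∷_)
open import Data.List.Relation.Unary.Linked as Linked using (Linked; []; [-]; _∷_)
open import Data.List.Relation.Unary.Linked.Properties using (map⁺)
open import Relation.Binary.PropositionalEquality
  using (_≡_; _≢_; refl; sym; trans; cong; cong₂; subst; subst₂; module ≡-Reasoning)

<-trans : ∀ {a b c} → a < b → b < c → a < c
<-trans 0<ω       (exp< q)  = 0<ω
<-trans 0<ω       (tail< q) = 0<ω
<-trans (exp< p)  (exp< q)  = exp< (<-trans p q)
<-trans (exp< p)  (tail< q) = exp< p
<-trans (tail< p) (exp< q)  = exp< q
<-trans (tail< p) (tail< q) = tail< (<-trans p q)

≤-trans : ∀ {a b c} → a ≤ b → b ≤ c → a ≤ c
≤-trans (inj₁ p)    (inj₁ q)    = inj₁ (<-trans p q)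
≤-trans (inj₁ p)    (inj₂ refl) = inj₁ p
≤-trans (inj₂ refl) q           = q

-- The boolean comparisons used by _⊕_ agree with the order: they are
-- what lets us evaluate a sum once the order of the exponents is known.

==ᵇ-refl : ∀ a → (a ==ᵇ a) ≡ true
==ᵇ-refl 𝟎          = refl
==ᵇ-refl (ω^ a + b) rewrite ==ᵇ-refl a | ==ᵇ-refl b = refl

<ᵇ-irrefl : ∀ a → (a <ᵇ a) ≡ false
<ᵇ-irrefl 𝟎          = refl
<ᵇ-irrefl (ω^ a + b) rewrite <ᵇ-irrefl a | ==ᵇ-refl a | <ᵇ-irrefl b = refl

mutual
  <⇒¬>ᵇ : ∀ {a b} → a < b → (b <ᵇ a) ≡ false
  <⇒¬>ᵇ 0<ω = refl
  <⇒¬>ᵇ (exp< p) rewrite <⇒¬>ᵇ p | <⇒¬==ᵇ p = refl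
  <⇒¬>ᵇ {ω^ a + _} (tail< p) rewrite <ᵇ-irrefl a | ==ᵇ-refl a | <⇒¬>ᵇ p = refl

  <⇒¬==ᵇ : ∀ {a b} → a < b → (b ==ᵇ a) ≡ false
  <⇒¬==ᵇ 0<ω = refl
  <⇒¬==ᵇ (exp< p) rewrite <⇒¬==ᵇ p = refl
  <⇒¬==ᵇ {ω^ a + _} (tail< p) rewrite ==ᵇ-refl a | <⇒¬==ᵇ p = refl

≤⇒¬>ᵇ : ∀ {a b} → b ≤ a → (a <ᵇ b) ≡ false
≤⇒¬>ᵇ (inj₁ p)        = <⇒¬>ᵇ p
≤⇒¬>ᵇ {a} (inj₂ refl) = <ᵇ-irrefl a

monomial : Ord → Ord
monomial e = ω^ e + 𝟎

Σω : List Ord → Ord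
Σω []       = 𝟎
Σω (e ∷ es) = ω^ e + Σω es

ω^+-injective : ∀ {a b c d} → ω^ a + b ≡ ω^ c + d → a ≡ c × b ≡ d
ω^+-injective refl = refl , refl

Σω-injective : ∀ {es fs} → Σω es ≡ Σω fs → es ≡ fs
Σω-injective {[]}    {[]}    _  = refl
Σω-injective {_ ∷ _} {_ ∷ _} eq with ω^+-injective eq
... | e₁ , e₂ = cong₂ _∷_ e₁ (Σω-injective e₂)

Decreasing : List Ord → Set
Decreasing = Linked (λ a b → b ≤ a)

Linked-init : ∀ {A : Set} {R : A → A → Set} xs {y} → Linked R (xs ++ [ y ]) → Linked R xs
Linked-init []           _       = []
Linked-init (x ∷ [])     _       = [-]
Linked-init (x ∷ z ∷ xs) (r ∷ l) = r ∷ Linked-init (z ∷ xs) l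

decreasing-last : ∀ x es {e} → Decreasing (x ∷ es ++ [ e ]) → e ≤ x
decreasing-last x []       (r ∷ _) = r
decreasing-last x (y ∷ es) (r ∷ l) = ≤-trans (decreasing-last y es l) r

sum-snoc : ∀ es e → Decreasing (es ++ [ e ]) → Σω es ⊕ monomial e ≡ Σω (es ++ [ e ])
sum-snoc []       e _ = refl
sum-snoc (x ∷ es) e l rewrite ≤⇒¬>ᵇ (decreasing-last x es l) =
  cong (ω^ x +_) (sum-snoc es e (Linked.tail l))

exponent : Rho → Ord
exponent N      = 𝟎
exponent (θ ⇒N) = rankT θ

rankR-monomial : ∀ ρ → rankR ρ ≡ monomial (exponent ρ)
rankR-monomial N      = refl
rankR-monomial (θ ⇒N) = refl

RankGe : Rho → Rho → Set
RankGe ρ ρ' = rankR ρ' ≤ rankR ρ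

rankGe⇒exponent≥ : ∀ {ρ ρ'} → RankGe ρ ρ' → exponent ρ' ≤ exponent ρ
rankGe⇒exponent≥ {ρ} {ρ'} r =
  monomial-≤ (subst₂ _≤_ (rankR-monomial ρ') (rankR-monomial ρ) r)
  where
  monomial-≤ : ∀ {a c} → monomial a ≤ monomial c → a ≤ c
  monomial-≤ (inj₁ (exp< p)) = inj₁ p
  monomial-≤ (inj₂ refl)     = inj₂ refl

exponent≥⇒rankGe : ∀ {ρ ρ'} → exponent ρ' ≤ exponent ρ → RankGe ρ ρ'
exponent≥⇒rankGe {ρ} {ρ'} r =
  subst₂ _≤_ (sym (rankR-monomial ρ')) (sym (rankR-monomial ρ)) (monomial-≤ r)
  where
  monomial-≤ : ∀ {a c} → a ≤ c → monomial a ≤ monomial c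
  monomial-≤ (inj₁ p)    = inj₁ (exp< p)
  monomial-≤ (inj₂ refl) = inj₂ refl

factors-nonempty : ∀ θ → factors θ ≢ []
factors-nonempty ⟨ ρ ⟩   ()
factors-nonempty (θ ⊗ ρ) e with ++-conicalʳ (factors θ) [ ρ ] e
... | ()

factors-injective : ∀ θ θ' → factors θ ≡ factors θ' → θ ≡ θ'
factors-injective ⟨ ρ ⟩   ⟨ ρ' ⟩    refl = refl
factors-injective ⟨ ρ ⟩   (θ' ⊗ ρ') e    =
  ⊥-elim (factors-nonempty θ' (sym (proj₁ (∷ʳ-injective [] (factors θ') e))))
factors-injective (θ ⊗ ρ) ⟨ ρ' ⟩    e    =
  ⊥-elim (factors-nonempty θ (proj₁ (∷ʳ-injective (factors θ) [] e)))
factors-injective (θ ⊗ ρ) (θ' ⊗ ρ') e with ∷ʳ-injective (factors θ) (factors θ') e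
... | e₁ , refl = cong (_⊗ ρ) (factors-injective θ θ' e₁)

fromFactors : Rho → List Rho → Theta
fromFactors x xs = foldl _⊗_ ⟨ x ⟩ xs

factors-fromFactors : ∀ x xs → factors (fromFactors x xs) ≡ x ∷ xs
factors-fromFactors x xs = go ⟨ x ⟩ xs
  where
  go : ∀ θ ys → factors (foldl _⊗_ θ ys) ≡ factors θ ++ ys
  go θ []       = sym (++-identityʳ (factors θ))
  go θ (y ∷ ys) = trans (go (θ ⊗ y) ys) (++-assoc (factors θ) [ y ] ys)

exponents : Theta → List Ord
exponents θ = map exponent (factors θ)

decreasing-exponents : ∀ {xs} → Linked RankGe xs → Decreasing (map exponent xs)
decreasing-exponents l = map⁺ (Linked.map rankGe⇒exponent≥ l)

rank-sorted : ∀ θ → Linked RankGe (factors θ) → rankT θ ≡ Σω (exponents θ)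
rank-sorted ⟨ ρ ⟩   _ = rankR-monomial ρ
rank-sorted (θ ⊗ ρ) l = begin
  rankT θ ⊕ rankR ρ
    ≡⟨ cong₂ _⊕_ (rank-sorted θ (Linked-init (factors θ) l)) (rankR-monomial ρ) ⟩
  Σω (exponents θ) ⊕ monomial (exponent ρ)
    ≡⟨ sum-snoc (exponents θ) (exponent ρ) decreasing ⟩
  Σω (exponents θ ++ [ exponent ρ ])
    ≡⟨ cong Σω (sym (map-++ exponent (factors θ) [ ρ ])) ⟩
  Σω (exponents (θ ⊗ ρ)) ∎
  where
  open ≡-Reasoning
  decreasing : Decreasing (exponents θ ++ [ exponent ρ ])
  decreasing = subst Decreasing (map-++ exponent (factors θ) [ ρ ]) (decreasing-exponents l)

rank-canonical : ∀ {θ} → CanonicalT θ → rankT θ ≡ Σω (exponents θ)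
rank-canonical {θ} (canProd _ l) = rank-sorted θ l

rank≢𝟎 : ∀ {θ} → CanonicalT θ → rankT θ ≢ 𝟎
rank≢𝟎 {θ} c eq with factors θ | factors-nonempty θ | trans (sym eq) (rank-canonical c)
... | []    | nonempty | _ = nonempty refl
... | _ ∷ _ | _        | ()

mutual
  exponent-injective : ∀ {ρ ρ'} → CanonicalR ρ → CanonicalR ρ' → exponent ρ ≡ exponent ρ' → ρ ≡ ρ'
  exponent-injective canN       canN        _ = refl
  exponent-injective canN       (canArr c)  e = ⊥-elim (rank≢𝟎 c (sym e))
  exponent-injective (canArr c) canN        e = ⊥-elim (rank≢𝟎 c e)
  exponent-injective (canArr c) (canArr c') e = cong _⇒N (rank-injective c c' e)

  rank-injective : ∀ {θ θ'} → CanonicalT θ → CanonicalT θ' → rankT θ ≡ rankT θ' → θ ≡ θ'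
  rank-injective {θ} {θ'} c@(canProd cs _) c'@(canProd cs' _) e =
    factors-injective θ θ' (exponents-injective cs cs'
      (Σω-injective (trans (sym (rank-canonical c)) (trans e (rank-canonical c')))))

  exponents-injective : ∀ {xs ys} → All CanonicalR xs → All CanonicalR ys →
                        map exponent xs ≡ map exponent ys → xs ≡ ys
  exponents-injective []       []       _ = refl
  exponents-injective (c ∷ cs) (d ∷ ds) e with ∷-injective e
  ... | e₁ , e₂ = cong₂ _∷_ (exponent-injective c d e₁) (exponents-injective cs ds e₂)

-- The three constructions call each other on the same or a smaller
-- normal form: a type of exponent ω^a + b ≠ 0 is θ → N for θ of that
-- rank; θ is assembled from a factor list for ω^a + b, whose head has
-- exponent a and whose tail is a factor list for b.

canonical-fromFactors : ∀ {x xs} → All CanonicalR (x ∷ xs) → Linked RankGe (x ∷ xs) →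
                        CanonicalT (fromFactors x xs)
canonical-fromFactors {x} {xs} cs l =
  canProd (subst (All CanonicalR) (sym eq) cs) (subst (Linked RankGe) (sym eq) l)
  where
  eq : factors (fromFactors x xs) ≡ x ∷ xs
  eq = factors-fromFactors x xs

prepend-sorted : ∀ {ρ ys} → LeadExp≤ (exponent ρ) (Σω (map exponent ys)) →
                 Linked RankGe ys → Linked RankGe (ρ ∷ ys)
prepend-sorted {ys = []}    _         _ = [-]
prepend-sorted {ys = _ ∷ _} (lead≤ p) l = exponent≥⇒rankGe p ∷ l

mutual
  typeOfExponent : (a : Ord) → IsCNF a → Σ Rho (λ ρ → CanonicalR ρ × exponent ρ ≡ a)
  typeOfExponent 𝟎            _ = N , canN , refl
  typeOfExponent a@(ω^ _ + _) c with typeOfRank a c 0<ω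
  ... | θ , cθ , rθ = θ ⇒N , canArr cθ , rθ

  typeOfRank : (α : Ord) → IsCNF α → 𝟎 < α → Σ Theta (λ θ → CanonicalT θ × rankT θ ≡ α)
  typeOfRank α c pos with sortedFactors α c
  typeOfRank .𝟎 c () | [] , _ , _ , refl
  ... | x ∷ xs , cs , l , eq =
    fromFactors x xs , cθ , rθ
    where
    cθ : CanonicalT (fromFactors x xs)
    cθ = canonical-fromFactors cs l
    rθ : rankT (fromFactors x xs) ≡ α
    rθ = trans (rank-canonical cθ)
               (trans (cong (λ ys → Σω (map exponent ys)) (factors-fromFactors x xs)) eq)

  sortedFactors : (α : Ord) → IsCNF α →
    Σ (List Rho) (λ xs → All CanonicalR xs × Linked RankGe xs × Σω (map exponent xs) ≡ α)
  sortedFactors 𝟎 _ = [] , [] , [] , refl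
  sortedFactors (ω^ a + b) (cnfω ca cb lead) with typeOfExponent a ca | sortedFactors b cb
  ... | ρ , cρ , refl | ys , cys , l , refl = ρ ∷ ys , cρ ∷ cys , prepend-sorted lead l , refl

mainTheorem2 : (α : Ord) → IsCNF α → 𝟎 < α →
    Σ Theta (λ σ → CanonicalT σ × rankT σ ≡ α ×
      ((τ : Theta) → CanonicalT τ → rankT τ ≡ α → τ ≡ σ))
mainTheorem2 α c pos with typeOfRank α c pos
... | σ , cσ , rσ = σ , cσ , rσ , λ τ cτ rτ → rank-injective cτ cσ (trans rτ (sym rσ))
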